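{- For linear expectations $h,h'\in\mathsf{LinExp}$ it is decidable whether $h\preceq h'$, i.e., whether $h(\sigma)\le h'(\sigma)$ for all states $\sigma$.
   Context: Program variables form a finite set $\mathsf{Vars}$; a state is a map $\sigma\colon\mathsf{Vars}\to\mathbb{N}$. Linear expressions: $e::= r\mid x\mid r\cdot e\mid e+e\mid e\mathbin{\dot- }e$ with $r\in\mathbb{Q}_{\ge0}$, $x\in\mathsf{Vars}$, where $\dot-$ is subtraction truncated at $0$. Extended linear expressions: $\tilde e::= e\mid\infty$. Linear guards: $\varphi::= e<e\mid\varphi\wedge\varphi\mid\neg\varphi$ (with $e$ linear expressions, no $\infty$). Linear expectations $\mathsf{LinExp}$: $h::=\tilde e\mid[\varphi]\cdot h\mid h+h$, evaluated on states pointwise (values in $\mathbb{R}_{\ge0}\cup\{\infty\}$) with $[\varphi](\sigma)\in\{0,1\}$ the truth value of $\varphi$, $0\cdot\infty=0$ and $a+\infty=\infty$. -}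

module Defs where

open import Data.Nat using (ℕ)
open import Data.Fin using (Fin)
open import Data.Bool using (Bool; true; false; _∧_; not; if_then_else_)
open import Data.Integer using (+_)
open import Data.Rational using (ℚ; 0ℚ; _/_; _+_; _-_; _*_; _⊔_; _≤_; _<_)
open import Data.Rational.Properties using (_<?_)
open import Relation.Nullary.Decidable using (⌊_⌋)

State : ℕ → Set
State n = Fin n → ℕ

data Expr (n : ℕ) : Set where
  const : (r : ℚ) → 0ℚ ≤ r → Expr n
  var   : Fin n → Expr n
  scale : (r : ℚ) → 0ℚ ≤ r → Expr n → Expr n
  plus  : Expr n → Expr n → Expr n
  monus : Expr n → Expr n → Expr n

_∸ℚ_ : ℚ → ℚ → ℚ
a ∸ℚ b = 0ℚ ⊔ (a - b)

⟦_⟧e : ∀ {n} → Expr n → State n → ℚ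
⟦ const r _ ⟧e σ   = r
⟦ var x ⟧e σ       = (+ (σ x)) / 1
⟦ scale r _ e ⟧e σ = r * ⟦ e ⟧e σ
⟦ plus e f ⟧e σ    = ⟦ e ⟧e σ + ⟦ f ⟧e σ
⟦ monus e f ⟧e σ   = ⟦ e ⟧e σ ∸ℚ ⟦ f ⟧e σ

data Guard (n : ℕ) : Set where
  lt   : Expr n → Expr n → Guard n
  conj : Guard n → Guard n → Guard n
  neg  : Guard n → Guard n

⟦_⟧g : ∀ {n} → Guard n → State n → Bool
⟦ lt e f ⟧g σ   = ⌊ ⟦ e ⟧e σ <? ⟦ f ⟧e σ ⌋
⟦ conj φ ψ ⟧g σ = ⟦ φ ⟧g σ ∧ ⟦ ψ ⟧g σ
⟦ neg φ ⟧g σ    = not (⟦ φ ⟧g σ)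

data ℚ∞ : Set where
  fin : ℚ → ℚ∞
  ∞   : ℚ∞

_+∞_ : ℚ∞ → ℚ∞ → ℚ∞
fin a +∞ fin b = fin (a + b)
fin _ +∞ ∞     = ∞
∞     +∞ _     = ∞

-- [b] · v  with  0 · ∞ = 0
iverson : Bool → ℚ∞ → ℚ∞
iverson b v = if b then v else fin 0ℚ

data _≤∞_ : ℚ∞ → ℚ∞ → Set where
  fin≤fin : ∀ {a b} → a ≤ b → fin a ≤∞ fin b
  _≤∞∞    : ∀ v → v ≤∞ ∞

data ExtExpr (n : ℕ) : Set where
  expr : Expr n → ExtExpr n
  inf  : ExtExpr n

⟦_⟧x : ∀ {n} → ExtExpr n → State n → ℚ∞
⟦ expr e ⟧x σ = fin (⟦ e ⟧e σ)
⟦ inf ⟧x σ    = ∞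

data LinExp (n : ℕ) : Set where
  ext   : ExtExpr n → LinExp n
  guard : Guard n → LinExp n → LinExp n
  add   : LinExp n → LinExp n → LinExp n

⟦_⟧ : ∀ {n} → LinExp n → State n → ℚ∞
⟦ ext x ⟧ σ     = ⟦ x ⟧x σ
⟦ guard φ h ⟧ σ = iverson (⟦ φ ⟧g σ) (⟦ h ⟧ σ)
⟦ add h k ⟧ σ   = ⟦ h ⟧ σ +∞ ⟦ k ⟧ σ

_⪯_ : ∀ {n} → LinExp n → LinExp n → Set
h ⪯ h' = ∀ σ → ⟦ h ⟧ σ ≤∞ ⟦ h' ⟧ σ

{-# OPTIONS --safe #-}
module Submission where

-- A linear expectation is piecewise affine: its guards and truncated subtractions only
-- branch on strict comparisons of rational affine functions of the state. Unfolding h and h'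
-- along these comparisons gives a decision tree whose leaves compare an affine function or ∞
-- on each side, and h ⋠ h' exactly when some state reaches a leaf where h exceeds h'. After
-- clearing denominators the conditions along a path are integer linear constraints, so
-- reachability is satisfiability over ℕ of a quantifier-free Presburger formula, which is
-- decided by eliminating the variables one at a time with Cooper's method.

open import Defs
open import Level using (0ℓ)
open import Algebra.Bundles using (CommutativeRing)
open import Data.Nat as ℕ using (ℕ; zero; suc)
import Data.Nat.Properties as ℕP
open import Data.Fin using (Fin; zero; suc)
open import Data.Vec using (Vec; []; _∷_; replicate; zipWith; map; lookup; tabulate)
open import Data.Product using (Σ; _×_; _,_; ∃-syntax)
open import Data.Sum using (_⊎_; inj₁; inj₂)
open import Data.Empty using (⊥; ⊥-elim)
open import Data.Unit using (⊤; tt)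
open import Function.Base using (_∘_)
open import Function.Bundles using (_⇔_; mk⇔; module Equivalence)
open import Function.Properties.Equivalence using () renaming (refl to ⇔-refl; sym to ⇔-sym; trans to ⇔-trans)
open import Relation.Nullary using (Dec; yes; no; ¬_; ¬?)
open import Relation.Nullary.Decidable as Dec using (⌊_⌋; _×-dec_; _⊎-dec_; map′; dec⇒maybe)
open import Relation.Binary.PropositionalEquality using (_≡_; refl; sym; trans; cong; cong₂; subst; subst₂; module ≡-Reasoning)
open import Data.Integer as ℤ using (ℤ; +_; 0ℤ)
import Data.Integer.Properties as ℤP
open import Data.Integer.Tactic.RingSolver using (solve-∀)

open Equivalence using (to; from)

module AffineForms (R : CommutativeRing 0ℓ 0ℓ) where

  open CommutativeRing R
    using (Carrier; _≈_; _+_; _*_; -_; _-_; 0#; 1#; ring; +-commutativeSemigroup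
          ; +-cong; +-congˡ; +-congʳ; +-assoc; +-identityˡ; +-identityʳ
          ; *-assoc; *-identityˡ; zeroˡ; zeroʳ; distribˡ; distribʳ)
    renaming (refl to ≈-refl; sym to ≈-sym; trans to ≈-trans)
  open import Algebra.Properties.Ring ring using (-1*x≈-x)
  open import Algebra.Properties.CommutativeSemigroup +-commutativeSemigroup using (interchange)

  Affine : ℕ → Set
  Affine m = Vec Carrier m × Carrier

  dot : ∀ {m} → Vec Carrier m → Vec Carrier m → Carrier
  dot []       []       = 0#
  dot (a ∷ as) (x ∷ xs) = a * x + dot as xs

  eval : ∀ {m} → Affine m → Vec Carrier m → Carrier
  eval (as , b) xs = dot as xs + b

  unit : ∀ {m} → Fin m → Vec Carrier m
  unit zero    = 1# ∷ replicate _ 0#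
  unit (suc i) = 0# ∷ unit i

  constᵃ : ∀ {m} → Carrier → Affine m
  constᵃ b = replicate _ 0# , b

  varᵃ : ∀ {m} → Fin m → Affine m
  varᵃ i = unit i , 0#

  infixl 6 _⊕_ _⊖_
  infixr 7 _⊛_
  infixr 5 _∷ᵃ_

  _∷ᵃ_ : ∀ {m} → Carrier → Affine m → Affine (suc m)
  c ∷ᵃ (cs , b) = c ∷ cs , b

  _⊕_ : ∀ {m} → Affine m → Affine m → Affine m
  (as , b) ⊕ (cs , d) = zipWith _+_ as cs , b + d

  _⊛_ : ∀ {m} → Carrier → Affine m → Affine m
  k ⊛ (as , b) = map (k *_) as , k * b

  _⊖_ : ∀ {m} → Affine m → Affine m → Affine m
  s ⊖ t = s ⊕ - 1# ⊛ t

  dot-replicate-0 : ∀ {m} (xs : Vec Carrier m) → dot (replicate m 0#) xs ≈ 0#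
  dot-replicate-0 []       = ≈-refl
  dot-replicate-0 (x ∷ xs) = ≈-trans (+-cong (zeroˡ x) (dot-replicate-0 xs)) (+-identityˡ 0#)

  dot-unit : ∀ {m} (i : Fin m) (xs : Vec Carrier m) → dot (unit i) xs ≈ lookup xs i
  dot-unit zero    (x ∷ xs) = ≈-trans (+-cong (*-identityˡ x) (dot-replicate-0 xs)) (+-identityʳ x)
  dot-unit (suc i) (x ∷ xs) = ≈-trans (+-cong (zeroˡ x) (dot-unit i xs)) (+-identityˡ _)

  dot-zipWith : ∀ {m} (as cs xs : Vec Carrier m) → dot (zipWith _+_ as cs) xs ≈ dot as xs + dot cs xs
  dot-zipWith []       []       []       = ≈-sym (+-identityˡ 0#)
  dot-zipWith (a ∷ as) (c ∷ cs) (x ∷ xs) =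
    ≈-trans (+-cong (distribʳ x a c) (dot-zipWith as cs xs)) (interchange (a * x) (c * x) _ _)

  dot-map : ∀ {m} k (as xs : Vec Carrier m) → dot (map (k *_) as) xs ≈ k * dot as xs
  dot-map k []       []       = ≈-sym (zeroʳ k)
  dot-map k (a ∷ as) (x ∷ xs) =
    ≈-trans (+-cong (*-assoc k a x) (dot-map k as xs)) (≈-sym (distribˡ k (a * x) _))

  eval-const : ∀ {m} b (xs : Vec Carrier m) → eval (constᵃ b) xs ≈ b
  eval-const b xs = ≈-trans (+-congʳ (dot-replicate-0 xs)) (+-identityˡ b)

  eval-var : ∀ {m} (i : Fin m) xs → eval (varᵃ i) xs ≈ lookup xs i
  eval-var i xs = ≈-trans (+-identityʳ _) (dot-unit i xs)

  eval-⊕ : ∀ {m} (s t : Affine m) xs → eval (s ⊕ t) xs ≈ eval s xs + eval t xs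
  eval-⊕ (as , b) (cs , d) xs = ≈-trans (+-congʳ (dot-zipWith as cs xs)) (interchange (dot as xs) _ b d)

  eval-⊛ : ∀ {m} k (t : Affine m) xs → eval (k ⊛ t) xs ≈ k * eval t xs
  eval-⊛ k (as , b) xs = ≈-trans (+-congʳ (dot-map k as xs)) (≈-sym (distribˡ k (dot as xs) b))

  eval-⊖ : ∀ {m} (s t : Affine m) xs → eval (s ⊖ t) xs ≈ eval s xs - eval t xs
  eval-⊖ s t xs = ≈-trans (eval-⊕ s _ xs) (+-congˡ (≈-trans (eval-⊛ (- 1#) t xs) (-1*x≈-x _)))

  eval-∷ᵃ : ∀ {m} c (t : Affine m) x xs → eval (c ∷ᵃ t) (x ∷ xs) ≈ c * x + eval t xs
  eval-∷ᵃ c (cs , b) x xs = +-assoc (c * x) (dot cs xs) b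

module ℤᵃ = AffineForms ℤP.+-*-commutativeRing

¬-cong-⇔ : ∀ {A B : Set} → A ⇔ B → (¬ A) ⇔ (¬ B)
¬-cong-⇔ A⇔B = mk⇔ (λ ¬a b → ¬a (from A⇔B b)) (λ ¬b a → ¬b (to A⇔B a))

module Presburger where

  open import Data.Integer using (+[1+_]; -[1+_]; 1ℤ; _+_; _*_; _<_; _≤_; _<?_; _≤?_; +<+; +≤+; -≤+)
  open import Data.Integer.Divisibility.Signed
    using (_∣_; _∣?_; divides; ∣-refl; ∣-trans; ∣m+n∣n⇒∣m; ∣m∣n⇒∣m+n; ∣n⇒∣m*n; ∣m⇒∣m*n
          ; *-cancelˡ-∣; *-monoʳ-∣)
  open import Data.Nat.Induction using (<-rec)
  open import Data.List using (List; []; _∷_; [_]; _++_; upTo)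
  open import Data.List.Relation.Unary.All using (All; []; _∷_)
  open import Data.List.Relation.Unary.All.Properties using (++⁻; ¬Any⇒All¬)
  open import Data.List.Relation.Unary.Any as Any using (Any; here; there; any?; satisfied)
  open import Data.List.Membership.Propositional using (lose)
  open import Data.List.Membership.Propositional.Properties using (∈-upTo⁺)
  open import Data.Product.Function.NonDependent.Propositional using (_×-⇔_)
  open import Data.Sum.Function.Propositional using (_⊎-⇔_)
  open ℤᵃ

  data Form (m : ℕ) : Set where
    ⊤ᶠ ⊥ᶠ     : Form m
    pos       : Affine m → Form m
    dvd ndvd  : ℕ → Affine m → Form m
    _∧ᶠ_ _∨ᶠ_ : Form m → Form m → Form m

  infixr 6 _∧ᶠ_
  infixr 5 _∨ᶠ_
  infix 4 _⊨_ _⊨?_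

  _⊨_ : ∀ {m} → Vec ℤ m → Form m → Set
  xs ⊨ ⊤ᶠ       = ⊤
  xs ⊨ ⊥ᶠ       = ⊥
  xs ⊨ pos t    = 0ℤ < eval t xs
  xs ⊨ dvd d t  = +[1+ d ] ∣ eval t xs
  xs ⊨ ndvd d t = ¬ (+[1+ d ] ∣ eval t xs)
  xs ⊨ (F ∧ᶠ G) = xs ⊨ F × xs ⊨ G
  xs ⊨ (F ∨ᶠ G) = xs ⊨ F ⊎ xs ⊨ G

  _⊨?_ : ∀ {m} (xs : Vec ℤ m) (F : Form m) → Dec (xs ⊨ F)
  xs ⊨? ⊤ᶠ       = yes tt
  xs ⊨? ⊥ᶠ       = no λ ()
  xs ⊨? pos t    = 0ℤ <? eval t xs
  xs ⊨? dvd d t  = +[1+ d ] ∣? eval t xs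
  xs ⊨? ndvd d t = ¬? (+[1+ d ] ∣? eval t xs)
  xs ⊨? (F ∧ᶠ G) = (xs ⊨? F) ×-dec (xs ⊨? G)
  xs ⊨? (F ∨ᶠ G) = (xs ⊨? F) ⊎-dec (xs ⊨? G)

  nonpos : ∀ {m} → Affine m → Form m
  nonpos t = pos (constᵃ 1ℤ ⊖ t)

  0<1-i⇔i≤0 : ∀ i → 0ℤ < 1ℤ ℤ.- i ⇔ i ≤ 0ℤ
  0<1-i⇔i≤0 i = mk⇔ to′ from′
    where
      to′ : 0ℤ < 1ℤ ℤ.- i → i ≤ 0ℤ
      to′ 0<1-i = ℤP.0≤i-j⇒j≤i (subst (0ℤ ≤_) (lemma i) (ℤP.i<j⇒i≤pred[j] 0<1-i))
        where lemma : ∀ i → ℤ.-1ℤ + (1ℤ ℤ.- i) ≡ 0ℤ ℤ.- i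
              lemma = solve-∀
      from′ : i ≤ 0ℤ → 0ℤ < 1ℤ ℤ.- i
      from′ i≤0 = ℤP.+-mono-<-≤ (+<+ (ℕ.s≤s ℕ.z≤n)) (ℤP.neg-mono-≤ i≤0)

  ⊨nonpos : ∀ {m} (xs : Vec ℤ m) t → xs ⊨ nonpos t ⇔ (¬ xs ⊨ pos t)
  ⊨nonpos xs t = mk⇔ (λ h → ℤP.≤⇒≯ (to (0<1-i⇔i≤0 _) (subst (0ℤ <_) v≡ h)))
                     (λ h → subst (0ℤ <_) (sym v≡) (from (0<1-i⇔i≤0 _) (ℤP.≮⇒≥ h)))
    where v≡ : eval (constᵃ 1ℤ ⊖ t) xs ≡ 1ℤ ℤ.- eval t xs
          v≡ = trans (eval-⊖ (constᵃ 1ℤ) t xs) (cong (ℤ._- eval t xs) (eval-const 1ℤ xs))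

  ⋁ : ∀ {m} {A : Set} → List A → (A → Form m) → Form m
  ⋁ []       g = ⊥ᶠ
  ⋁ (a ∷ as) g = g a ∨ᶠ ⋁ as g

  ⊨⋁⁺ : ∀ {m} {A : Set} {xs : Vec ℤ m} (as : List A) {g} → Any (λ a → xs ⊨ g a) as → xs ⊨ ⋁ as g
  ⊨⋁⁺ (a ∷ as) (here h)  = inj₁ h
  ⊨⋁⁺ (a ∷ as) (there h) = inj₂ (⊨⋁⁺ as h)

  ⊨⋁⁻ : ∀ {m} {A : Set} {xs : Vec ℤ m} (as : List A) {g} → xs ⊨ ⋁ as g → Any (λ a → xs ⊨ g a) as
  ⊨⋁⁻ (a ∷ as) (inj₁ h) = here h
  ⊨⋁⁻ (a ∷ as) (inj₂ h) = there (⊨⋁⁻ as h)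

  instantiateᵃ : ∀ {m} → ℕ → Affine m → Affine (suc m) → Affine m
  instantiateᵃ a p (c ∷ cs , k) = c ⊛ p ⊕ +[1+ a ] ⊛ (cs , k)

  instantiate : ∀ {m} → ℕ → Affine m → Form (suc m) → Form m
  instantiate a p ⊤ᶠ         = ⊤ᶠ
  instantiate a p ⊥ᶠ         = ⊥ᶠ
  instantiate a p (pos t)    = pos (instantiateᵃ a p t)
  instantiate a p (dvd d t)  = dvd (d ℕ.+ a ℕ.* suc d) (instantiateᵃ a p t)
  instantiate a p (ndvd d t) = ndvd (d ℕ.+ a ℕ.* suc d) (instantiateᵃ a p t)
  instantiate a p (F ∧ᶠ G)   = instantiate a p F ∧ᶠ instantiate a p G
  instantiate a p (F ∨ᶠ G)   = instantiate a p F ∨ᶠ instantiate a p G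

  eval-instantiateᵃ : ∀ {m} a (p : Affine m) t y xs → +[1+ a ] * y ≡ eval p xs →
                      eval (instantiateᵃ a p t) xs ≡ +[1+ a ] * eval t (y ∷ xs)
  eval-instantiateᵃ a p (c ∷ cs , k) y xs p≡ = begin
    eval (c ⊛ p ⊕ A ⊛ (cs , k)) xs           ≡⟨ eval-⊕ (c ⊛ p) _ xs ⟩
    eval (c ⊛ p) xs + eval (A ⊛ (cs , k)) xs ≡⟨ cong₂ _+_ (eval-⊛ c p xs) (eval-⊛ A (cs , k) xs) ⟩
    c * eval p xs + A * r                    ≡⟨ cong (λ v → c * v + A * r) (sym p≡) ⟩
    c * (A * y) + A * r                      ≡⟨ lemma c A y r ⟩
    A * (c * y + r)                          ≡⟨ cong (A *_) (sym (eval-∷ᵃ c (cs , k) y xs)) ⟩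
    A * eval (c ∷ cs , k) (y ∷ xs)           ∎
    where
      open ≡-Reasoning
      A = +[1+ a ]
      r = eval (cs , k) xs
      lemma : ∀ c A y r → c * (A * y) + A * r ≡ A * (c * y + r)
      lemma = solve-∀

  pos-scale : ∀ a z → 0ℤ < +[1+ a ] * z ⇔ 0ℤ < z
  pos-scale a z = mk⇔ (λ h → ℤP.*-cancelˡ-<-nonNeg +[1+ a ] (subst (_< +[1+ a ] * z) (sym (ℤP.*-zeroʳ +[1+ a ])) h))
                      (λ h → subst (_< +[1+ a ] * z) (ℤP.*-zeroʳ +[1+ a ]) (ℤP.*-monoˡ-<-pos +[1+ a ] h))

  dvd-scale : ∀ a d z → +[1+ a ] * +[1+ d ] ∣ +[1+ a ] * z ⇔ +[1+ d ] ∣ z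
  dvd-scale a d z = mk⇔ (*-cancelˡ-∣ +[1+ a ]) (*-monoʳ-∣ +[1+ a ])

  instantiate-correct : ∀ {m} a (p : Affine m) F y xs → +[1+ a ] * y ≡ eval p xs →
                        xs ⊨ instantiate a p F ⇔ y ∷ xs ⊨ F
  instantiate-correct a p ⊤ᶠ         y xs p≡ = mk⇔ _ _
  instantiate-correct a p ⊥ᶠ         y xs p≡ = mk⇔ (λ ()) (λ ())
  instantiate-correct a p (pos t)    y xs p≡ rewrite eval-instantiateᵃ a p t y xs p≡ = pos-scale a _
  instantiate-correct a p (dvd d t)  y xs p≡ rewrite eval-instantiateᵃ a p t y xs p≡ = dvd-scale a d _
  instantiate-correct a p (ndvd d t) y xs p≡ rewrite eval-instantiateᵃ a p t y xs p≡ = ¬-cong-⇔ (dvd-scale a d _)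
  instantiate-correct a p (F ∧ᶠ G)   y xs p≡ = instantiate-correct a p F y xs p≡ ×-⇔ instantiate-correct a p G y xs p≡
  instantiate-correct a p (F ∨ᶠ G)   y xs p≡ = instantiate-correct a p F y xs p≡ ⊎-⇔ instantiate-correct a p G y xs p≡

  LowerBound : ℕ → Set
  LowerBound m = ℕ × Affine m

  boundAtom : ∀ {m} → LowerBound m → Affine (suc m)
  boundAtom (a , t) = +[1+ a ] ∷ᵃ t

  lowerBounds : ∀ {m} → Form (suc m) → List (LowerBound m)
  lowerBounds (pos (+[1+ a ] ∷ cs , k)) = [ a , (cs , k) ]
  lowerBounds (F ∧ᶠ G)                  = lowerBounds F ++ lowerBounds G
  lowerBounds (F ∨ᶠ G)                  = lowerBounds F ++ lowerBounds G
  lowerBounds _                         = []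

  period : ∀ {m} → Form m → ℕ
  period (dvd d _)  = suc d
  period (ndvd d _) = suc d
  period (F ∧ᶠ G)   = period F ℕ.* period G
  period (F ∨ᶠ G)   = period F ℕ.* period G
  period _          = 1

  0<period : ∀ {m} (F : Form m) → 0 ℕ.< period F
  0<period ⊤ᶠ         = ℕ.s≤s ℕ.z≤n
  0<period ⊥ᶠ         = ℕ.s≤s ℕ.z≤n
  0<period (pos _)    = ℕ.s≤s ℕ.z≤n
  0<period (dvd _ _)  = ℕ.s≤s ℕ.z≤n
  0<period (ndvd _ _) = ℕ.s≤s ℕ.z≤n
  0<period (F ∧ᶠ G)   = ℕP.*-mono-≤ (0<period F) (0<period G)
  0<period (F ∨ᶠ G)   = ℕP.*-mono-≤ (0<period F) (0<period G)

  ModuliDivide : ∀ {m} → Form m → ℤ → Set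
  ModuliDivide (dvd d _)  D = +[1+ d ] ∣ D
  ModuliDivide (ndvd d _) D = +[1+ d ] ∣ D
  ModuliDivide (F ∧ᶠ G)   D = ModuliDivide F D × ModuliDivide G D
  ModuliDivide (F ∨ᶠ G)   D = ModuliDivide F D × ModuliDivide G D
  ModuliDivide _          D = ⊤

  moduliDivide-∣ : ∀ {m} (F : Form m) {D E} → ModuliDivide F D → D ∣ E → ModuliDivide F E
  moduliDivide-∣ ⊤ᶠ         _          _   = tt
  moduliDivide-∣ ⊥ᶠ         _          _   = tt
  moduliDivide-∣ (pos _)    _          _   = tt
  moduliDivide-∣ (dvd _ _)  q∣D        D∣E = ∣-trans q∣D D∣E
  moduliDivide-∣ (ndvd _ _) q∣D        D∣E = ∣-trans q∣D D∣E
  moduliDivide-∣ (F ∧ᶠ G)   (mF , mG)  D∣E = moduliDivide-∣ F mF D∣E , moduliDivide-∣ G mG D∣E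
  moduliDivide-∣ (F ∨ᶠ G)   (mF , mG)  D∣E = moduliDivide-∣ F mF D∣E , moduliDivide-∣ G mG D∣E

  moduliDivide-period : ∀ {m} (F : Form m) → ModuliDivide F (+ period F)
  moduliDivide-product : ∀ {m} (F G : Form m) →
                         ModuliDivide F (+ (period F ℕ.* period G)) × ModuliDivide G (+ (period F ℕ.* period G))

  moduliDivide-period ⊤ᶠ         = tt
  moduliDivide-period ⊥ᶠ         = tt
  moduliDivide-period (pos _)    = tt
  moduliDivide-period (dvd _ _)  = ∣-refl
  moduliDivide-period (ndvd _ _) = ∣-refl
  moduliDivide-period (F ∧ᶠ G)   = moduliDivide-product F G
  moduliDivide-period (F ∨ᶠ G)   = moduliDivide-product F G

  moduliDivide-product F G rewrite ℤP.pos-* (period F) (period G) =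
    moduliDivide-∣ F (moduliDivide-period F) (∣m⇒∣m*n (+ period G) ∣-refl) ,
    moduliDivide-∣ G (moduliDivide-period G) (∣n⇒∣m*n (+ period F) ∣-refl)

  -- The extra bound 0 < y + 1 expresses that y ranges over the natural numbers.
  bounds : ∀ {m} → Form (suc m) → List (LowerBound m)
  bounds F = (0 , constᵃ 1ℤ) ∷ lowerBounds F

  window : ∀ {m} → Form (suc m) → LowerBound m → ℕ
  window F (a , _) = suc a ℕ.* period F

  numerator : ∀ {m} → ℕ → Affine m → Affine m
  numerator k t = constᵃ +[1+ k ] ⊖ t

  -- The disjunct y = numerator k t / (1 + a), that is (1 + a) · y + t = 1 + k.
  candidate : ∀ {m} → Form (suc m) → LowerBound m → ℕ → Form m
  candidate F (a , t) k = dvd a p ∧ᶠ pos (p ⊕ constᵃ 1ℤ) ∧ᶠ instantiate a p F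
    where p = numerator k t

  eliminate : ∀ {m} → Form (suc m) → Form m
  eliminate F = ⋁ (bounds F) λ b → ⋁ (upTo (window F b)) (candidate F b)

  eval-numerator : ∀ {m} k t (xs : Vec ℤ m) → eval (numerator k t) xs ≡ +[1+ k ] ℤ.- eval t xs
  eval-numerator k t xs = trans (eval-⊖ (constᵃ +[1+ k ]) t xs) (cong (ℤ._- eval t xs) (eval-const +[1+ k ] xs))

  eval-+1 : ∀ {m} (p : Affine m) xs → eval (p ⊕ constᵃ 1ℤ) xs ≡ eval p xs + 1ℤ
  eval-+1 p xs = trans (eval-⊕ p (constᵃ 1ℤ) xs) (cong (_+_ (eval p xs)) (eval-const 1ℤ xs))

  0<i+1⇒0≤i : ∀ i → 0ℤ < i + 1ℤ → 0ℤ ≤ i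
  0<i+1⇒0≤i i h = subst (0ℤ ≤_) (lemma i) (ℤP.i<j⇒i≤pred[j] h)
    where lemma : ∀ i → ℤ.-1ℤ + (i + 1ℤ) ≡ i
          lemma = solve-∀

  0<n+1 : ∀ n → 0ℤ < + n + 1ℤ
  0<n+1 n = subst (λ k → 0ℤ < + k) (ℕP.+-comm 1 n) (+<+ (ℕ.s≤s ℕ.z≤n))

  nonNegative-quotient : ∀ a q → 0ℤ ≤ q * +[1+ a ] → ∃[ y ] q ≡ + y
  nonNegative-quotient a (+ y) _ = y , refl
  nonNegative-quotient a -[1+ n ] ()

  candidate-sound : ∀ {m} (F : Form (suc m)) b k {xs} → xs ⊨ candidate F b k → ∃[ y ] + y ∷ xs ⊨ F
  candidate-sound F (a , t) k {xs} (divides q p≡ , p+1>0 , h)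
    with y , refl ← nonNegative-quotient a q
                      (subst (0ℤ ≤_) p≡ (0<i+1⇒0≤i _ (subst (0ℤ <_) (eval-+1 (numerator k t) xs) p+1>0)))
    = y , to (instantiate-correct a (numerator k t) F (+ y) xs (trans (ℤP.*-comm +[1+ a ] (+ y)) (sym p≡))) h

  eliminate-sound : ∀ {m} (F : Form (suc m)) {xs} → xs ⊨ eliminate F → ∃[ y ] + y ∷ xs ⊨ F
  eliminate-sound F h with b , h₁ ← satisfied (⊨⋁⁻ (bounds F) h)
                      with k , h₂ ← satisfied (⊨⋁⁻ (upTo (window F b)) h₁)
                      = candidate-sound F b k h₂

  InWindow : ∀ {m} → ℕ → ℤ → Vec ℤ m → LowerBound m → Set
  InWindow D y xs (a , t) = 0ℤ < v × v ≤ + (suc a ℕ.* D)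
    where v = eval (boundAtom (a , t)) (y ∷ xs)

  inWindow? : ∀ {m} D y (xs : Vec ℤ m) b → Dec (InWindow D y xs b)
  inWindow? D y xs (a , t) = (0ℤ <? _) ×-dec (_ ≤? _)

  positive⇒suc : ∀ {v} → 0ℤ < v → ∃[ k ] v ≡ +[1+ k ]
  positive⇒suc {+[1+ k ]} _         = k , refl
  positive⇒suc {+ zero}   (+<+ ())

  candidate-complete : ∀ {m} (F : Form (suc m)) b {y xs} → InWindow (period F) (+ y) xs b →
                       + y ∷ xs ⊨ F → xs ⊨ ⋁ (upTo (window F b)) (candidate F b)
  candidate-complete F (a , t) {y} {xs} (v>0 , v≤W) h
    with k , v≡ ← positive⇒suc v>0
    = ⊨⋁⁺ (upTo _) (lose (∈-upTo⁺ (ℤP.drop‿+≤+ (subst (_≤ _) v≡ v≤W))) (a∣p , p+1>0 , inst))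
    where
      p = numerator k t
      p≡ : +[1+ a ] * + y ≡ eval p xs
      p≡ = sym (begin
        eval p xs                                     ≡⟨ eval-numerator k t xs ⟩
        +[1+ k ] ℤ.- eval t xs                        ≡⟨ cong (ℤ._- eval t xs) (sym v≡) ⟩
        eval (boundAtom (a , t)) (+ y ∷ xs) ℤ.- eval t xs ≡⟨ cong (ℤ._- eval t xs) (eval-∷ᵃ +[1+ a ] t (+ y) xs) ⟩
        +[1+ a ] * + y + eval t xs ℤ.- eval t xs      ≡⟨ lemma (+[1+ a ] * + y) (eval t xs) ⟩
        +[1+ a ] * + y                                ∎)
        where
          open ≡-Reasoning
          lemma : ∀ u v → u + v ℤ.- v ≡ u
          lemma = solve-∀
      a∣p : +[1+ a ] ∣ eval p xs
      a∣p = divides (+ y) (trans (sym p≡) (ℤP.*-comm +[1+ a ] (+ y)))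
      p+1>0 : 0ℤ < eval (p ⊕ constᵃ 1ℤ) xs
      p+1>0 = subst (0ℤ <_) (sym (trans (eval-+1 p xs) (cong (ℤ._+ 1ℤ) (sym (trans (ℤP.pos-* (suc a) y) p≡))))) (0<n+1 _)
      inst : xs ⊨ instantiate a p F
      inst = from (instantiate-correct a p F (+ y) xs p≡) h

  eval-shift : ∀ {m} c (t : Affine m) D y xs →
               eval (c ∷ᵃ t) (+ D + y ∷ xs) ≡ eval (c ∷ᵃ t) (y ∷ xs) + c * + D
  eval-shift c t D y xs = begin
    eval (c ∷ᵃ t) (+ D + y ∷ xs)         ≡⟨ eval-∷ᵃ c t (+ D + y) xs ⟩
    c * (+ D + y) + eval t xs            ≡⟨ lemma c (+ D) y (eval t xs) ⟩
    c * y + eval t xs + c * + D          ≡⟨ cong (_+ c * + D) (sym (eval-∷ᵃ c t y xs)) ⟩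
    eval (c ∷ᵃ t) (y ∷ xs) + c * + D     ∎
    where
      open ≡-Reasoning
      lemma : ∀ c D y r → c * (D + y) + r ≡ c * y + r + c * D
      lemma = solve-∀

  0<u+v⇒0<u : ∀ {u v} → v ≤ 0ℤ → 0ℤ < u + v → 0ℤ < u
  0<u+v⇒0<u {u} v≤0 h = ℤP.<-≤-trans h (subst (u + _ ≤_) (ℤP.+-identityʳ u) (ℤP.+-monoʳ-≤ u v≤0))

  u+v≰v⇒0<u : ∀ {u v} → ¬ (u + v ≤ v) → 0ℤ < u
  u+v≰v⇒0<u {u} {v} u+v≰v = ℤP.≰⇒> (λ u≤0 → u+v≰v (subst (u + v ≤_) (ℤP.+-identityˡ v) (ℤP.+-monoˡ-≤ v u≤0)))

  i≤0⇒i*+n≤0 : ∀ i n → i ≤ 0ℤ → i * + n ≤ 0ℤ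
  i≤0⇒i*+n≤0 i n i≤0 = ℤP.*-monoʳ-≤-nonNeg (+ n) i≤0

  ∣u+v⇔∣u : ∀ {q u v} → q ∣ v → q ∣ u + v ⇔ q ∣ u
  ∣u+v⇔∣u q∣v = mk⇔ (λ h → ∣m+n∣n⇒∣m h q∣v) (λ h → ∣m∣n⇒∣m+n h q∣v)

  shift-down : ∀ {m} (F : Form (suc m)) D {y xs} → ModuliDivide F (+ D) →
               All (λ b → ¬ InWindow D (+ D + y) xs b) (lowerBounds F) →
               + D + y ∷ xs ⊨ F → y ∷ xs ⊨ F
  shift-down ⊤ᶠ D _ _ _ = tt
  shift-down (pos (+[1+ a ] ∷ cs , k)) D {y} {xs} _ (outside ∷ []) h =
    u+v≰v⇒0<u (λ u+AD≤AD → outside (h , subst₂ _≤_ (sym (eval-shift +[1+ a ] (cs , k) D y xs))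
                                                   (sym (ℤP.pos-* (suc a) D)) u+AD≤AD))
  shift-down (pos (+ zero ∷ cs , k)) D {y} {xs} _ _ h =
    0<u+v⇒0<u (i≤0⇒i*+n≤0 0ℤ D ℤP.≤-refl) (subst (0ℤ <_) (eval-shift 0ℤ (cs , k) D y xs) h)
  shift-down (pos (-[1+ n ] ∷ cs , k)) D {y} {xs} _ _ h =
    0<u+v⇒0<u (i≤0⇒i*+n≤0 -[1+ n ] D -≤+) (subst (0ℤ <_) (eval-shift -[1+ n ] (cs , k) D y xs) h)
  shift-down (dvd d (c ∷ cs , k)) D {y} {xs} q∣D _ h =
    to (∣u+v⇔∣u (∣n⇒∣m*n c q∣D)) (subst (+[1+ d ] ∣_) (eval-shift c (cs , k) D y xs) h)
  shift-down (ndvd d (c ∷ cs , k)) D {y} {xs} q∣D _ h =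
    to (¬-cong-⇔ (∣u+v⇔∣u (∣n⇒∣m*n c q∣D))) (subst (λ v → ¬ (+[1+ d ] ∣ v)) (eval-shift c (cs , k) D y xs) h)
  shift-down (F ∧ᶠ G) D (mF , mG) outside (hF , hG) with oF , oG ← ++⁻ (lowerBounds F) outside =
    shift-down F D mF oF hF , shift-down G D mG oG hG
  shift-down (F ∨ᶠ G) D (mF , mG) outside (inj₁ hF) with oF , _ ← ++⁻ (lowerBounds F) outside =
    inj₁ (shift-down F D mF oF hF)
  shift-down (F ∨ᶠ G) D (mF , mG) outside (inj₂ hG) with _ , oG ← ++⁻ (lowerBounds F) outside =
    inj₂ (shift-down G D mG oG hG)

  first-window : ∀ {m} D y (xs : Vec ℤ m) → y ℕ.< D → InWindow D (+ y) xs (0 , constᵃ 1ℤ)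
  first-window D y xs y<D = subst (λ v → 0ℤ < v × v ≤ + (1 ℕ.* D)) (sym v≡)
                              (0<n+1 y , +≤+ (subst₂ ℕ._≤_ (ℕP.+-comm 1 y) (sym (ℕP.*-identityˡ D)) y<D))
    where v≡ : eval (1ℤ ∷ᵃ constᵃ 1ℤ) (+ y ∷ xs) ≡ + y + 1ℤ
          v≡ = trans (eval-∷ᵃ 1ℤ (constᵃ 1ℤ) (+ y) xs) (cong₂ _+_ (ℤP.*-identityˡ (+ y)) (eval-const 1ℤ xs))

  -- A solution outside every window can be lowered by the period, so the least solution lies in some window.
  eliminate-complete : ∀ {m} (F : Form (suc m)) {xs} y → + y ∷ xs ⊨ F → xs ⊨ eliminate F
  eliminate-complete F {xs} = <-rec _ step
    where
      D = period F
      step : ∀ y → (∀ {y′} → y′ ℕ.< y → + y′ ∷ xs ⊨ F → xs ⊨ eliminate F) → + y ∷ xs ⊨ F → xs ⊨ eliminate F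
      step y rec h with any? (inWindow? D (+ y) xs) (bounds F)
      ... | yes hit = ⊨⋁⁺ (bounds F) (Any.map (λ {b} w → candidate-complete F b w h) hit)
      ... | no miss with outside₀ ∷ outside ← ¬Any⇒All¬ (bounds F) miss
                    with y′ , refl ← ℕP.m≤n⇒∃[o]m+o≡n (ℕP.≮⇒≥ (λ y<D → outside₀ (first-window D y xs y<D)))
                    = rec (ℕP.m<n+m y′ (0<period F)) (shift-down F D (moduliDivide-period F) outside h)

  Satisfiable : ∀ {m} → Form m → Set
  Satisfiable {m} F = Σ (Vec ℕ m) λ ys → map +_ ys ⊨ F

  satisfiable? : ∀ {m} (F : Form m) → Dec (Satisfiable F)
  satisfiable? {zero}  F = map′ ([] ,_) (λ { ([] , h) → h }) ([] ⊨? F)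
  satisfiable? {suc m} F = map′ extend restrict (satisfiable? (eliminate F))
    where
      extend : Satisfiable (eliminate F) → Satisfiable F
      extend (ys , h) with y , h′ ← eliminate-sound F h = y ∷ ys , h′
      restrict : Satisfiable F → Satisfiable (eliminate F)
      restrict (y ∷ ys , h) = ys , eliminate-complete F y h

open import Data.Rational as ℚ using (ℚ; 0ℚ; _+_; _*_; _<_; _<?_; ↥_; ↧_; toℚᵘ)
import Data.Rational.Properties as ℚP
import Data.Rational.Unnormalised as ℚᵘ
import Data.Rational.Unnormalised.Properties as ℚᵘP
open import Data.Maybe using (Maybe; just; nothing)
open import Data.Bool using (Bool; true; false; _∧_; not; if_then_else_)
open import Data.Bool.Properties using (¬-not; not-¬)
open import Data.Vec.Properties using (lookup-map; lookup∘tabulate; tabulate∘lookup; tabulate-∘)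
import Tactic.RingSolver as RingSolver
open import Tactic.RingSolver.Core.AlmostCommutativeRing using (AlmostCommutativeRing; fromCommutativeRing)

ι : ℤ → ℚ
ι z = z ℚ./ 1

toℚᵘ-ι : ∀ z → toℚᵘ (ι z) ℚᵘ.≃ ℚᵘ.mkℚᵘ z 0
toℚᵘ-ι z = ℚP.toℚᵘ-fromℚᵘ (ℚᵘ.mkℚᵘ z 0)

ι-+ : ∀ a b → ι (a ℤ.+ b) ≡ ι a + ι b
ι-+ a b = ℚP.toℚᵘ-injective (begin
  toℚᵘ (ι (a ℤ.+ b))                     ≈⟨ toℚᵘ-ι (a ℤ.+ b) ⟩
  ℚᵘ.mkℚᵘ (a ℤ.+ b) 0                    ≈⟨ ℚᵘ.*≡* (lemma a b) ⟩
  ℚᵘ.mkℚᵘ a 0 ℚᵘ.+ ℚᵘ.mkℚᵘ b 0            ≈⟨ ℚᵘP.+-cong (toℚᵘ-ι a) (toℚᵘ-ι b) ⟨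
  toℚᵘ (ι a) ℚᵘ.+ toℚᵘ (ι b)              ≈⟨ ℚP.toℚᵘ-homo-+ (ι a) (ι b) ⟨
  toℚᵘ (ι a + ι b)                       ∎)
  where
    open import Relation.Binary.Reasoning.Setoid ℚᵘP.≃-setoid
    lemma : ∀ a b → (a ℤ.+ b) ℤ.* ℤ.1ℤ ≡ (a ℤ.* ℤ.1ℤ ℤ.+ b ℤ.* ℤ.1ℤ) ℤ.* ℤ.1ℤ
    lemma = solve-∀

ι-* : ∀ a b → ι (a ℤ.* b) ≡ ι a * ι b
ι-* a b = ℚP.toℚᵘ-injective (begin
  toℚᵘ (ι (a ℤ.* b))                     ≈⟨ toℚᵘ-ι (a ℤ.* b) ⟩
  ℚᵘ.mkℚᵘ (a ℤ.* b) 0                    ≈⟨ ℚᵘP.*-cong (toℚᵘ-ι a) (toℚᵘ-ι b) ⟨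
  toℚᵘ (ι a) ℚᵘ.* toℚᵘ (ι b)              ≈⟨ ℚP.toℚᵘ-homo-* (ι a) (ι b) ⟨
  toℚᵘ (ι a * ι b)                       ∎)
  where open import Relation.Binary.Reasoning.Setoid ℚᵘP.≃-setoid

0<ι⇔0< : ∀ z → 0ℚ < ι z ⇔ 0ℤ ℤ.< z
0<ι⇔0< z = mk⇔ to′ from′
  where
    to′ : 0ℚ < ι z → 0ℤ ℤ.< z
    to′ h with ℚᵘ.*<* l ← ℚᵘP.<-respʳ-≃ (toℚᵘ-ι z) (ℚP.toℚᵘ-mono-< h) = subst (0ℤ ℤ.<_) (ℤP.*-identityʳ z) l
    from′ : 0ℤ ℤ.< z → 0ℚ < ι z
    from′ h = ℚP.toℚᵘ-cancel-< (ℚᵘP.<-respʳ-≃ (ℚᵘP.≃-sym (toℚᵘ-ι z))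
                                  (ℚᵘ.*<* (subst (0ℤ ℤ.<_) (sym (ℤP.*-identityʳ z)) h)))

ι↧*≡ι↥ : ∀ q → ι (↧ q) * q ≡ ι (↥ q)
ι↧*≡ι↥ q@record{} = ℚP.toℚᵘ-injective (begin
  toℚᵘ (ι (↧ q) * q)                         ≈⟨ ℚP.toℚᵘ-homo-* (ι (↧ q)) q ⟩
  toℚᵘ (ι (↧ q)) ℚᵘ.* toℚᵘ q                  ≈⟨ ℚᵘP.*-congʳ (toℚᵘ-ι (↧ q)) ⟩
  ℚᵘ.mkℚᵘ (↧ q) 0 ℚᵘ.* toℚᵘ q                 ≈⟨ ℚᵘ.*≡* (lemma (↥ q) (ℚ.denominator-1 q)) ⟩
  ℚᵘ.mkℚᵘ (↥ q) 0                            ≈⟨ toℚᵘ-ι (↥ q) ⟨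
  toℚᵘ (ι (↥ q))                             ∎)
  where
    open import Relation.Binary.Reasoning.Setoid ℚᵘP.≃-setoid
    lemma : ∀ n d → (ℤ.+[1+ d ] ℤ.* n) ℤ.* ℤ.1ℤ ≡ n ℤ.* ℤ.+[1+ d ℕ.+ 0 ]
    lemma n d = trans (commute ℤ.+[1+ d ] n) (cong (λ e → n ℤ.* ℤ.+[1+ e ]) (sym (ℕP.+-identityʳ d)))
      where commute : ∀ D n → (D ℤ.* n) ℤ.* ℤ.1ℤ ≡ n ℤ.* D
            commute = solve-∀

module ℚᵃ = AffineForms ℚP.+-*-commutativeRing
open ℚᵃ using (constᵃ; varᵃ; _⊕_; _⊛_; _⊖_; _∷ᵃ_)

ℚ-ring : AlmostCommutativeRing 0ℓ 0ℓ
ℚ-ring = fromCommutativeRing ℚP.+-*-commutativeRing (λ q → dec⇒maybe (0ℚ ℚP.≟ q))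

multiplier : ∀ {n} → ℚᵃ.Affine n → ℤ
multiplier ([] , k)     = ↧ k
multiplier (q ∷ cs , k) = ↧ q ℤ.* multiplier (cs , k)

cleared : ∀ {n} → ℚᵃ.Affine n → ℤᵃ.Affine n
cleared ([] , k)     = [] , ↥ k
cleared (q ∷ cs , k) = multiplier (cs , k) ℤ.* ↥ q ℤᵃ.∷ᵃ ↧ q ℤᵃ.⊛ cleared (cs , k)

0<multiplier : ∀ {n} (L : ℚᵃ.Affine n) → 0ℤ ℤ.< multiplier L
0<multiplier ([] , k)     = ℤ.+<+ (ℕ.s≤s ℕ.z≤n)
0<multiplier (q ∷ cs , k) =
  subst (ℤ._< multiplier (q ∷ cs , k)) (ℤP.*-zeroʳ (↧ q)) (ℤP.*-monoˡ-<-pos (↧ q) (0<multiplier (cs , k)))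

cleared-correct : ∀ {n} (L : ℚᵃ.Affine n) xs → ι (multiplier L) * ℚᵃ.eval L (map ι xs) ≡ ι (ℤᵃ.eval (cleared L) xs)
cleared-correct ([] , k) [] =
  trans (cong (ι (↧ k) *_) (ℚP.+-identityˡ k)) (trans (ι↧*≡ι↥ k) (cong ι (sym (ℤP.+-identityˡ (↥ k)))))
cleared-correct (q ∷ cs , k) (x ∷ xs) = begin
  ι (D ℤ.* M) * ℚᵃ.eval (q ∷ᵃ (cs , k)) (ι x ∷ map ι xs)
    ≡⟨ cong₂ _*_ (ι-* D M) (ℚᵃ.eval-∷ᵃ q (cs , k) (ι x) (map ι xs)) ⟩
  ι D * ι M * (q * ι x + R)
    ≡⟨ rearrange (ι D) (ι M) q (ι x) R ⟩
  ι M * (ι D * q) * ι x + ι D * (ι M * R)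
    ≡⟨ cong₂ (λ a b → ι M * a * ι x + ι D * b) (ι↧*≡ι↥ q) (cleared-correct (cs , k) xs) ⟩
  ι M * ι (↥ q) * ι x + ι D * ι T
    ≡⟨ cong₂ _+_ (trans (cong (_* ι x) (sym (ι-* M (↥ q)))) (sym (ι-* (M ℤ.* ↥ q) x))) (sym (ι-* D T)) ⟩
  ι (M ℤ.* ↥ q ℤ.* x) + ι (D ℤ.* T)
    ≡⟨ sym (ι-+ (M ℤ.* ↥ q ℤ.* x) (D ℤ.* T)) ⟩
  ι (M ℤ.* ↥ q ℤ.* x ℤ.+ D ℤ.* T)
    ≡⟨ cong (λ v → ι (M ℤ.* ↥ q ℤ.* x ℤ.+ v)) (sym (ℤᵃ.eval-⊛ D (cleared (cs , k)) xs)) ⟩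
  ι (M ℤ.* ↥ q ℤ.* x ℤ.+ ℤᵃ.eval (D ℤᵃ.⊛ cleared (cs , k)) xs)
    ≡⟨ cong ι (sym (ℤᵃ.eval-∷ᵃ (M ℤ.* ↥ q) (D ℤᵃ.⊛ cleared (cs , k)) x xs)) ⟩
  ι (ℤᵃ.eval (cleared (q ∷ cs , k)) (x ∷ xs))
    ∎
  where
    open ≡-Reasoning
    D = ↧ q
    M = multiplier (cs , k)
    R = ℚᵃ.eval (cs , k) (map ι xs)
    T = ℤᵃ.eval (cleared (cs , k)) xs
    rearrange : ∀ d m q x r → d * m * (q * x + r) ≡ m * (d * q) * x + d * (m * r)
    rearrange = RingSolver.solve-∀ ℚ-ring

0<cleared⇔0< : ∀ {n} (L : ℚᵃ.Affine n) xs → 0ℤ ℤ.< ℤᵃ.eval (cleared L) xs ⇔ 0ℚ < ℚᵃ.eval L (map ι xs)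
0<cleared⇔0< L xs = mk⇔ to′ from′
  where
    m = ι (multiplier L)
    v = ℚᵃ.eval L (map ι xs)
    instance
      m>0 : ℚ.Positive m
      m>0 = ℚ.positive (from (0<ι⇔0< _) (0<multiplier L))
      m≥0 : ℚ.NonNegative m
      m≥0 = ℚP.pos⇒nonNeg m
    to′ : 0ℤ ℤ.< ℤᵃ.eval (cleared L) xs → 0ℚ < v
    to′ h = ℚP.*-cancelˡ-<-nonNeg m (subst₂ _<_ (sym (ℚP.*-zeroʳ m)) (sym (cleared-correct L xs)) (from (0<ι⇔0< _) h))
    from′ : 0ℚ < v → 0ℤ ℤ.< ℤᵃ.eval (cleared L) xs
    from′ h = to (0<ι⇔0< _) (subst₂ _<_ (ℚP.*-zeroʳ m) (cleared-correct L xs) (ℚP.*-monoʳ-<-pos m h))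

0<q-p⇔p<q : ∀ p q → 0ℚ < q ℚ.- p ⇔ p < q
0<q-p⇔p<q p q = mk⇔ to′ from′
  where
    to′ : 0ℚ < q ℚ.- p → p < q
    to′ h = subst₂ _<_ (ℚP.+-identityˡ p) (cancel q p) (ℚP.+-monoˡ-< p h)
      where cancel : ∀ q p → q ℚ.- p + p ≡ q
            cancel = RingSolver.solve-∀ ℚ-ring
    from′ : p < q → 0ℚ < q ℚ.- p
    from′ h = subst (_< q ℚ.- p) (ℚP.+-inverseʳ p) (ℚP.+-monoˡ-< (ℚ.- p) h)

point : ∀ {n} → State n → Vec ℤ n
point σ = tabulate λ i → + σ i

value : ∀ {n} → ℚᵃ.Affine n → State n → ℚ
value L σ = ℚᵃ.eval L (map ι (point σ))

data DecisionTree (A : Set) (n : ℕ) : Set where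
  leaf : A → DecisionTree A n
  node : ℚᵃ.Affine n → ℚᵃ.Affine n → DecisionTree A n → DecisionTree A n → DecisionTree A n

reach : ∀ {A n} → DecisionTree A n → State n → A
reach (leaf a)       σ = a
reach (node L M t u) σ = if ⌊ value L σ <? value M σ ⌋ then reach t σ else reach u σ

_>>=_ : ∀ {A B n} → DecisionTree A n → (A → DecisionTree B n) → DecisionTree B n
leaf a       >>= k = k a
node L M t u >>= k = node L M (t >>= k) (u >>= k)

reach->>= : ∀ {A B n} (t : DecisionTree A n) (k : A → DecisionTree B n) σ → reach (t >>= k) σ ≡ reach (k (reach t σ)) σ
reach->>= (leaf a)       k σ = refl
reach->>= (node L M t u) k σ with ⌊ value L σ <? value M σ ⌋
... | true  = reach->>= t k σ
... | false = reach->>= u k σ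

reach->>=₂ : ∀ {A B C n} (t : DecisionTree A n) (u : DecisionTree B n) (k : A → B → DecisionTree C n) σ →
             reach (t >>= λ a → u >>= λ b → k a b) σ ≡ reach (k (reach t σ) (reach u σ)) σ
reach->>=₂ t u k σ = trans (reach->>= t _ σ) (reach->>= u _ σ)

linearise : ∀ {n} → Expr n → DecisionTree (ℚᵃ.Affine n) n
linearise (const r _)   = leaf (constᵃ r)
linearise (var x)       = leaf (varᵃ x)
linearise (scale r _ e) = linearise e >>= λ L → leaf (r ⊛ L)
linearise (plus e f)    = linearise e >>= λ L → linearise f >>= λ M → leaf (L ⊕ M)
linearise (monus e f)   = linearise e >>= λ L → linearise f >>= λ M → node M L (leaf (L ⊖ M)) (leaf (constᵃ 0ℚ))

value-var : ∀ {n} (x : Fin n) σ → value (varᵃ x) σ ≡ ⟦ var x ⟧e σ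
value-var x σ = begin
  value (varᵃ x) σ           ≡⟨ ℚᵃ.eval-var x (map ι (point σ)) ⟩
  lookup (map ι (point σ)) x ≡⟨ lookup-map x ι (point σ) ⟩
  ι (lookup (point σ) x)     ≡⟨ cong ι (lookup∘tabulate _ x) ⟩
  ⟦ var x ⟧e σ               ∎
  where open ≡-Reasoning

∸ℚ-cases : ∀ {n} (L M : ℚᵃ.Affine n) σ →
           value L σ ∸ℚ value M σ ≡ value (reach (node M L (leaf (L ⊖ M)) (leaf (constᵃ 0ℚ))) σ) σ
∸ℚ-cases L M σ with value M σ <? value L σ
... | yes M<L = trans (ℚP.p≤q⇒p⊔q≡q (ℚP.<⇒≤ (from (0<q-p⇔p<q _ _) M<L))) (sym (ℚᵃ.eval-⊖ L M (map ι (point σ))))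
... | no M≮L  = trans (ℚP.p≥q⇒p⊔q≡p (subst (value L σ ℚ.- value M σ ℚ.≤_) (ℚP.+-inverseʳ (value M σ))
                                              (ℚP.+-monoˡ-≤ (ℚ.- value M σ) (ℚP.≮⇒≥ M≮L))))
                      (sym (ℚᵃ.eval-const 0ℚ (map ι (point σ))))

linearise-correct : ∀ {n} (e : Expr n) σ → ⟦ e ⟧e σ ≡ value (reach (linearise e) σ) σ
linearise-correct (const r _)   σ = sym (ℚᵃ.eval-const r (map ι (point σ)))
linearise-correct (var x)       σ = sym (value-var x σ)
linearise-correct (scale r r≥0 e) σ = begin
  r * ⟦ e ⟧e σ                      ≡⟨ cong (r *_) (linearise-correct e σ) ⟩
  r * value (reach (linearise e) σ) σ ≡⟨ ℚᵃ.eval-⊛ r (reach (linearise e) σ) (map ι (point σ)) ⟨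
  value (r ⊛ reach (linearise e) σ) σ ≡⟨ cong (λ L → value L σ) (reach->>= (linearise e) _ σ) ⟨
  value (reach (linearise (scale r r≥0 e)) σ) σ ∎
  where open ≡-Reasoning
linearise-correct (plus e f) σ = begin
  ⟦ e ⟧e σ + ⟦ f ⟧e σ         ≡⟨ cong₂ _+_ (linearise-correct e σ) (linearise-correct f σ) ⟩
  value L σ + value M σ       ≡⟨ ℚᵃ.eval-⊕ L M (map ι (point σ)) ⟨
  value (L ⊕ M) σ             ≡⟨ cong (λ L → value L σ) (reach->>=₂ (linearise e) (linearise f) _ σ) ⟨
  value (reach (linearise (plus e f)) σ) σ ∎
  where
    open ≡-Reasoning
    L = reach (linearise e) σ
    M = reach (linearise f) σ
linearise-correct (monus e f) σ = begin
  ⟦ e ⟧e σ ∸ℚ ⟦ f ⟧e σ        ≡⟨ cong₂ _∸ℚ_ (linearise-correct e σ) (linearise-correct f σ) ⟩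
  value L σ ∸ℚ value M σ      ≡⟨ ∸ℚ-cases L M σ ⟩
  value (reach (node M L (leaf (L ⊖ M)) (leaf (constᵃ 0ℚ))) σ) σ
                              ≡⟨ cong (λ L → value L σ) (reach->>=₂ (linearise e) (linearise f) _ σ) ⟨
  value (reach (linearise (monus e f)) σ) σ ∎
  where
    open ≡-Reasoning
    L = reach (linearise e) σ
    M = reach (linearise f) σ

decide : ∀ {n} → Guard n → DecisionTree Bool n
decide (lt e f)   = linearise e >>= λ L → linearise f >>= λ M → node L M (leaf true) (leaf false)
decide (conj φ ψ) = decide φ >>= λ b → decide ψ >>= λ c → leaf (b ∧ c)
decide (neg φ)    = decide φ >>= λ b → leaf (not b)

reach-comparison : ∀ {n} (L M : ℚᵃ.Affine n) σ → reach (node L M (leaf true) (leaf false)) σ ≡ ⌊ value L σ <? value M σ ⌋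
reach-comparison L M σ with ⌊ value L σ <? value M σ ⌋
... | true  = refl
... | false = refl

decide-correct : ∀ {n} (φ : Guard n) σ → ⟦ φ ⟧g σ ≡ reach (decide φ) σ
decide-correct (lt e f) σ = begin
  ⌊ ⟦ e ⟧e σ <? ⟦ f ⟧e σ ⌋
    ≡⟨ cong₂ (λ a b → ⌊ a <? b ⌋) (linearise-correct e σ) (linearise-correct f σ) ⟩
  ⌊ value L σ <? value M σ ⌋                          ≡⟨ reach-comparison L M σ ⟨
  reach (node L M (leaf true) (leaf false)) σ         ≡⟨ reach->>=₂ (linearise e) (linearise f) _ σ ⟨
  reach (decide (lt e f)) σ                           ∎
  where
    open ≡-Reasoning
    L = reach (linearise e) σ
    M = reach (linearise f) σ
decide-correct (conj φ ψ) σ =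
  trans (cong₂ _∧_ (decide-correct φ σ) (decide-correct ψ σ)) (sym (reach->>=₂ (decide φ) (decide ψ) _ σ))
decide-correct (neg φ)    σ = trans (cong not (decide-correct φ σ)) (sym (reach->>= (decide φ) _ σ))

value∞ : ∀ {n} → Maybe (ℚᵃ.Affine n) → State n → ℚ∞
value∞ (just L) σ = fin (value L σ)
value∞ nothing  σ = ∞

_⊕∞_ : ∀ {n} → Maybe (ℚᵃ.Affine n) → Maybe (ℚᵃ.Affine n) → Maybe (ℚᵃ.Affine n)
just L ⊕∞ just M = just (L ⊕ M)
_      ⊕∞ _      = nothing

value∞-⊕∞ : ∀ {n} (u v : Maybe (ℚᵃ.Affine n)) σ → value∞ (u ⊕∞ v) σ ≡ value∞ u σ +∞ value∞ v σ
value∞-⊕∞ (just L) (just M) σ = cong fin (ℚᵃ.eval-⊕ L M (map ι (point σ)))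
value∞-⊕∞ (just L) nothing  σ = refl
value∞-⊕∞ nothing  (just M) σ = refl
value∞-⊕∞ nothing  nothing  σ = refl

linearise∞ : ∀ {n} → LinExp n → DecisionTree (Maybe (ℚᵃ.Affine n)) n
linearise∞ (ext (expr e)) = linearise e >>= λ L → leaf (just L)
linearise∞ (ext inf)      = leaf nothing
linearise∞ (guard φ h)    = decide φ >>= λ b → if b then linearise∞ h else leaf (just (constᵃ 0ℚ))
linearise∞ (add h k)      = linearise∞ h >>= λ u → linearise∞ k >>= λ v → leaf (u ⊕∞ v)

linearise∞-correct : ∀ {n} (h : LinExp n) σ → ⟦ h ⟧ σ ≡ value∞ (reach (linearise∞ h) σ) σ
linearise∞-correct (ext (expr e)) σ =
  trans (cong fin (linearise-correct e σ)) (cong (λ u → value∞ u σ) (sym (reach->>= (linearise e) _ σ)))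
linearise∞-correct (ext inf)      σ = refl
linearise∞-correct (guard φ h)    σ
  rewrite decide-correct φ σ | reach->>= (decide φ) (λ b → if b then linearise∞ h else leaf (just (constᵃ 0ℚ))) σ
  with reach (decide φ) σ
... | true  = linearise∞-correct h σ
... | false = cong fin (sym (ℚᵃ.eval-const 0ℚ (map ι (point σ))))
linearise∞-correct (add h k)      σ = begin
  ⟦ h ⟧ σ +∞ ⟦ k ⟧ σ                 ≡⟨ cong₂ _+∞_ (linearise∞-correct h σ) (linearise∞-correct k σ) ⟩
  value∞ u σ +∞ value∞ v σ           ≡⟨ value∞-⊕∞ u v σ ⟨
  value∞ (u ⊕∞ v) σ                  ≡⟨ cong (λ w → value∞ w σ) (reach->>=₂ (linearise∞ h) (linearise∞ k) _ σ) ⟨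
  value∞ (reach (linearise∞ (add h k)) σ) σ ∎
  where
    open ≡-Reasoning
    u = reach (linearise∞ h) σ
    v = reach (linearise∞ k) σ

exceeds : ∀ {n} → Maybe (ℚᵃ.Affine n) → Maybe (ℚᵃ.Affine n) → DecisionTree Bool n
exceeds (just L) (just M) = node M L (leaf true) (leaf false)
exceeds nothing  (just M) = leaf true
exceeds _        nothing  = leaf false

exceeds-false⇔≤∞ : ∀ {n} (u v : Maybe (ℚᵃ.Affine n)) σ → reach (exceeds u v) σ ≡ false ⇔ value∞ u σ ≤∞ value∞ v σ
exceeds-false⇔≤∞ (just L) (just M) σ with value M σ <? value L σ
... | yes M<L = mk⇔ (λ ()) (λ { (fin≤fin L≤M) → ⊥-elim (ℚP.<-irrefl refl (ℚP.<-≤-trans M<L L≤M)) })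
... | no M≮L  = mk⇔ (λ _ → fin≤fin (ℚP.≮⇒≥ M≮L)) (λ _ → refl)
exceeds-false⇔≤∞ nothing  (just M) σ = mk⇔ (λ ()) (λ ())
exceeds-false⇔≤∞ (just L) nothing  σ = mk⇔ (λ _ → _ ≤∞∞) (λ _ → refl)
exceeds-false⇔≤∞ nothing  nothing  σ = mk⇔ (λ _ → _ ≤∞∞) (λ _ → refl)

Reachable : ∀ {n} → DecisionTree Bool n → Set
Reachable t = ∃[ σ ] reach t σ ≡ true

violation : ∀ {n} → LinExp n → LinExp n → DecisionTree Bool n
violation h h′ = linearise∞ h >>= λ u → linearise∞ h′ >>= λ v → exceeds u v

violation-false⇔≤∞ : ∀ {n} (h h′ : LinExp n) σ → reach (violation h h′) σ ≡ false ⇔ ⟦ h ⟧ σ ≤∞ ⟦ h′ ⟧ σ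
violation-false⇔≤∞ h h′ σ
  rewrite reach->>=₂ (linearise∞ h) (linearise∞ h′) exceeds σ | linearise∞-correct h σ | linearise∞-correct h′ σ
  = exceeds-false⇔≤∞ (reach (linearise∞ h) σ) (reach (linearise∞ h′) σ) σ

⪯⇔unviolated : ∀ {n} (h h′ : LinExp n) → h ⪯ h′ ⇔ (¬ Reachable (violation h h′))
⪯⇔unviolated h h′ = mk⇔
  (λ h⪯h′ (σ , e) → not-¬ e (from (violation-false⇔≤∞ h h′ σ) (h⪯h′ σ)))
  (λ unviolated σ → to (violation-false⇔≤∞ h h′ σ) (¬-not λ e → unviolated (σ , e)))

open Presburger using (Form; ⊤ᶠ; ⊥ᶠ; pos; nonpos; _∧ᶠ_; _∨ᶠ_; _⊨_; ⊨nonpos; Satisfiable; satisfiable?)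

⊨cleared⇔< : ∀ {n} (L M : ℚᵃ.Affine n) σ → point σ ⊨ pos (cleared (M ⊖ L)) ⇔ value L σ < value M σ
⊨cleared⇔< L M σ = ⇔-trans (0<cleared⇔0< (M ⊖ L) (point σ))
                  (⇔-trans (subst (λ v → 0ℚ < value (M ⊖ L) σ ⇔ 0ℚ < v) (ℚᵃ.eval-⊖ M L (map ι (point σ))) ⇔-refl)
                           (0<q-p⇔p<q (value L σ) (value M σ)))

toForm : ∀ {n} → DecisionTree Bool n → Form n
toForm (leaf b)       = if b then ⊤ᶠ else ⊥ᶠ
toForm (node L M t u) = pos d ∧ᶠ toForm t ∨ᶠ nonpos d ∧ᶠ toForm u
  where d = cleared (M ⊖ L)

⊨toForm⇔reach : ∀ {n} (t : DecisionTree Bool n) σ → point σ ⊨ toForm t ⇔ reach t σ ≡ true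
⊨toForm⇔reach (leaf true)    σ = mk⇔ (λ _ → refl) _
⊨toForm⇔reach (leaf false)   σ = mk⇔ (λ ()) (λ ())
⊨toForm⇔reach (node L M t u) σ with value L σ <? value M σ
... | yes L<M = mk⇔ (λ { (inj₁ (_ , ht)) → to (⊨toForm⇔reach t σ) ht
                       ; (inj₂ (≮ , _))  → ⊥-elim (to (⊨nonpos (point σ) d) ≮ (from (⊨cleared⇔< L M σ) L<M)) })
                    (λ e → inj₁ (from (⊨cleared⇔< L M σ) L<M , from (⊨toForm⇔reach t σ) e))
  where d = cleared (M ⊖ L)
... | no L≮M  = mk⇔ (λ { (inj₁ (< , _))  → ⊥-elim (L≮M (to (⊨cleared⇔< L M σ) <))
                       ; (inj₂ (_ , hu)) → to (⊨toForm⇔reach u σ) hu })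
                    (λ e → inj₂ (from (⊨nonpos (point σ) d) (L≮M ∘ to (⊨cleared⇔< L M σ)) ,
                                 from (⊨toForm⇔reach u σ) e))
  where d = cleared (M ⊖ L)

reachable? : ∀ {n} (t : DecisionTree Bool n) → Dec (Reachable t)
reachable? t = Dec.map (mk⇔ reached witness) (satisfiable? (toForm t))
  where
    point-lookup : ∀ {n} (ys : Vec ℕ n) → point (lookup ys) ≡ map (λ k → + k) ys
    point-lookup ys = trans (tabulate-∘ (λ k → + k) (lookup ys)) (cong (map (λ k → + k)) (tabulate∘lookup ys))
    reached : Satisfiable (toForm t) → Reachable t
    reached (ys , h) = lookup ys , to (⊨toForm⇔reach t (lookup ys)) (subst (_⊨ toForm t) (sym (point-lookup ys)) h)
    witness : Reachable t → Satisfiable (toForm t)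
    witness (σ , e) = tabulate σ , subst (_⊨ toForm t) (tabulate-∘ (λ k → + k) σ) (from (⊨toForm⇔reach t σ) e)

theorem7 : ∀ {n : ℕ} (h h' : LinExp n) → Dec (h ⪯ h')
theorem7 h h' = Dec.map (⇔-sym (⪯⇔unviolated h h')) (¬? (reachable? (violation h h')))
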